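{- Let $n>1$, let $\lambda$ be a partition with $1\le|\lambda|\le n+1$, let $j\ge0$ be such that $\lambda^{(j)}$ is defined, and set $a=\lambda'_{j+1}$. Let $S\subseteq\{2,\dots,n\}$ and let $d$ be an integer with $d>|S|-p^{n-1}_{|S|}(\lambda^{(j)})$. Define $$F_{d,S}:=\begin{cases}x_1^{a}\,e_d(S\sqcup\{1\}) & \text{if } |S|\ge n-j,\\ x_1^{a}\,e_d(S) & \text{if } |S|<n-j.\end{cases}$$ Then $F_{d,S}$ is a homogeneous polynomial lying in $J_{n,\lambda}$, and $F_{d,S}-x_1^{a}e_d(S)$ is divisible by $x_1^{a+1}$.
   Context: For $S\subseteq[n]$ and an integer $d$, $e_d(S)$ is the elementary symmetric polynomial of degree $d$ in $\{x_i:i\in S\}$, with $e_0(S)=1$ and $e_d(S)=0$ if $d>|S|$ or $d<0$. For a partition $\lambda$, $\lambda'$ is its conjugate, and for $N\ge m\ge0$, $p^N_m(\lambda):=\lambda'_{N-m+1}+\lambda'_{N-m+2}+\cdots$. $\lambda^{(0)}:=\lambda$, and for $j\ge1$, $\lambda^{(j)}$ is the partition whose conjugate is obtained from $\lambda'$ by decreasing its $j$-th entry by 1 (defined exactly when $\lambda'_j>\lambda'_{j+1}$). $J_{n,\lambda}$ is the ideal of $\mathbb{Z}[x_1,\dots,x_n]$ generated by all $e_d(S)$ with $S\subseteq[n]$ and $d>|S|-p^n_{|S|}(\lambda)$. -}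

module Defs where

open import Data.Bool using (Bool; true; false; if_then_else_; _∧_; not; _∨_)
open import Data.Nat as ℕ using (ℕ; zero; suc; _⊔_; _∸_)
open import Data.Integer as ℤ using (ℤ; +_; _-_; _<_; _≤_)
open import Data.List as L using (List; []; _∷_; _++_; map; concatMap; length; filterᵇ; applyUpTo; drop; foldr)
import Data.Nat.ListAction as ListAction
open import Data.List.Relation.Unary.All using (All)
open import Data.List.Relation.Unary.Linked using (Linked)
open import Data.Vec as V using (Vec; []; _∷_; tabulate; zipWith)
open import Data.Fin using (Fin; toℕ)
open import Data.Fin.Subset using (Subset; ∣_∣) public
open import Data.Product using (Σ; ∃; _×_; _,_)
open import Relation.Binary.PropositionalEquality using (_≡_)
open import Relation.Nullary using (¬_; does)

IsPartition : List ℕ → Set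
IsPartition λ′ = Linked ℕ._≥_ λ′ × All (0 ℕ.<_) λ′

size : List ℕ → ℕ
size = ListAction.sum

-- conjugate entry  λ'_k = #{ i : λ_i ≥ k }   (meaningful for k ≥ 1)
conjAt : List ℕ → ℕ → ℕ
conjAt λ′ k = length (filterᵇ (λ x → does (k ℕ.≤? x)) λ′)

conj : List ℕ → List ℕ
conj λ′ = applyUpTo (λ i → conjAt λ′ (suc i)) (foldr _⊔_ 0 λ′)

-- decrease the k-th entry (1-indexed) of a list by one
decAt : ℕ → List ℕ → List ℕ
decAt k       []       = []
decAt zero    (x ∷ xs) = x ∷ xs
decAt (suc zero) (x ∷ xs) = (x ∸ 1) ∷ xs
decAt (suc (suc k)) (x ∷ xs) = x ∷ decAt (suc k) xs

lamj : List ℕ → ℕ → List ℕ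
lamj λ′ zero    = λ′
lamj λ′ (suc j) = conj (decAt (suc j) (conj λ′))

LamjDefined : List ℕ → ℕ → Set
LamjDefined λ′ zero    = Data.Unit.⊤ where import Data.Unit
LamjDefined λ′ (suc j) = conjAt λ′ (suc (suc j)) ℕ.< conjAt λ′ (suc j)

pNm : ℕ → ℕ → List ℕ → ℕ
pNm N m λ′ = ListAction.sum (drop (N ∸ m) (conj λ′))

-- Polynomials in ℤ[x_1,...,x_n]: finite lists of terms (coefficient,
-- exponent vector); variable x_{i+1} corresponds to position i.

Mono : ℕ → Set
Mono n = Vec ℕ n

Poly : ℕ → Set
Poly n = List (ℤ × Mono n)

monoEqᵇ : ∀ {n} → Mono n → Mono n → Bool
monoEqᵇ []       []       = true
monoEqᵇ (a ∷ as) (b ∷ bs) = does (a ℕ.≟ b) ∧ monoEqᵇ as bs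

coeff : ∀ {n} → Poly n → Mono n → ℤ
coeff []             m = + 0
coeff ((c , e) ∷ ts) m = (if monoEqᵇ e m then c else + 0) ℤ.+ coeff ts m

infix 4 _≈P_
_≈P_ : ∀ {n} → Poly n → Poly n → Set
p ≈P q = ∀ m → coeff p m ≡ coeff q m

infixl 6 _+P_ _-P_
infixl 7 _*P_

_+P_ : ∀ {n} → Poly n → Poly n → Poly n
p +P q = p ++ q

negP : ∀ {n} → Poly n → Poly n
negP = map (λ { (c , e) → (ℤ.- c , e) })

_-P_ : ∀ {n} → Poly n → Poly n → Poly n
p -P q = p +P negP q

_*P_ : ∀ {n} → Poly n → Poly n → Poly n
p *P q = concatMap (λ { (c , e) → map (λ { (c′ , e′) → (c ℤ.* c′ , zipWith ℕ._+_ e e′) }) q }) p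

sumP : ∀ {n} → List (Poly n) → Poly n
sumP = foldr _+P_ []

x1^ : ∀ {n} → ℕ → Poly n
x1^ a = (+ 1 , tabulate (λ i → if does (toℕ i ℕ.≟ 0) then a else 0)) ∷ []

Homogeneous : ∀ {n} → Poly n → Set
Homogeneous {n} p = ∃ λ k → ∀ (m : Mono n) → ¬ (coeff p m ≡ + 0) → V.sum m ≡ k

_∣P_ : ∀ {n} → Poly n → Poly n → Set
_∣P_ {n} g f = Σ (Poly n) λ q → f ≈P g *P q

allSubsets : (n : ℕ) → List (Subset n)
allSubsets zero    = [] ∷ []
allSubsets (suc n) = map (false ∷_) (allSubsets n) ++ map (true ∷_) (allSubsets n)

⊆ᵇ : ∀ {n} → Subset n → Subset n → Bool
⊆ᵇ []       []       = true
⊆ᵇ (t ∷ ts) (s ∷ ss) = (not t ∨ s) ∧ ⊆ᵇ ts ss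

toExp : ∀ {n} → Subset n → Mono n
toExp = V.map (λ b → if b then 1 else 0)

-- e_d(S) = Σ_{T ⊆ S, |T| = d} Π_{i∈T} x_i   (d ∈ ℤ; zero if d < 0 or d > |S|)
e : ∀ {n} → ℤ → Subset n → Poly n
e {n} d S = map (λ T → (+ 1 , toExp T))
              (filterᵇ (λ T → ⊆ᵇ T S ∧ does (+ ∣ T ∣ ℤ.≟ d)) (allSubsets n))

addFirst : ∀ {n} → Subset n → Subset n
addFirst []       = []
addFirst (_ ∷ xs) = true ∷ xs

FirstNotIn : ∀ {n} → Subset n → Set
FirstNotIn {n} S = ∀ (i : Fin n) → toℕ i ≡ 0 → V.lookup S i ≡ false

-- a generator e_d(S) of J_{n,λ}, multiplied by a coefficient polynomial
GenTerm : ℕ → Set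
GenTerm n = Poly n × Subset n × ℤ

GenOK : ∀ {n} → List ℕ → GenTerm n → Set
GenOK {n} λ′ (c , S , d) = + ∣ S ∣ - + pNm n ∣ S ∣ λ′ < d

genVal : ∀ {n} → GenTerm n → Poly n
genVal (c , S , d) = c *P e d S

InJ : (n : ℕ) → List ℕ → Poly n → Set
InJ n λ′ F = Σ (List (GenTerm n)) λ gs → All (GenOK λ′) gs × F ≈P sumP (map genVal gs)

F : (n j a : ℕ) → ℤ → Subset n → Poly n
F n j a d S = if does ((n ∸ j) ℕ.≤? ∣ S ∣)
              then x1^ a *P e d (addFirst S)
              else x1^ a *P e d S

module Submission where

-- Write m = |S|, K = (n - 1) - m and p_K(μ) = μ'_{K+1} + μ'_{K+2} + ⋯, so that p^N_m = p_{N-m}.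
-- Since λ^{(j)} shortens the column λ'_j by one, p_K(λ^{(j)}) = p_K(λ) - 1 for K < j and
-- p_K(λ^{(j)}) = p_K(λ) for K ≥ j; only antitonicity of conjugates is needed here, the tail sums
-- being computed by counting cells of Young diagrams.
--
-- If |S| ≥ n - j then K < j, and the hypothesis on d says exactly that e_d(S ⊔ {1}) is a
-- generator of J_{n,λ}; moreover e_d(S ⊔ {1}) - e_d(S) = x₁ e_{d-1}(S).
--
-- If |S| < n - j then K ≥ j, so e_{d'}(S ⊔ {1}) is a generator for every d' > d, and so is
-- e_{d+a}(S) because p_{K+1}(λ) = p_K(λ) - λ'_{K+1} with λ'_{K+1} ≤ λ'_{j+1} = a. Induction on a,
-- using x₁^{a+1} e_d(S) = x₁^a e_{d+1}(S ⊔ {1}) - x₁^a e_{d+1}(S), then puts x₁^a e_d(S) in J_{n,λ}.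


open import Defs
open import Data.Nat using (ℕ; suc; _<_; _≤_)
open import Data.Integer using (ℤ; +_; _-_)
open import Data.List using (List)
open import Data.Fin.Subset using (Subset; ∣_∣)
open import Data.Product using (_×_)

open import Data.Bool using (Bool; true; false; if_then_else_; _∧_; T)
open import Data.Bool.Properties using (T-∧)
open import Data.Fin using (toℕ)
open import Data.Fin.Subset.Properties using (∣p∣≤n)
import Data.Integer as ℤ
import Data.Integer.Properties as ℤₚ
import Data.Integer.Tactic.RingSolver as ℤ-Solver
open import Data.List using ([]; _∷_; _++_; map; drop; applyUpTo; filterᵇ; foldr)
import Data.List.Properties as List
open import Data.List.Relation.Unary.All as All using (All; []; _∷_)
import Data.List.Relation.Unary.All.Properties as All
open import Data.Nat using (zero; _+_; _∸_; _⊔_; z≤n; s≤s; s≤s⁻¹; _≤?_; _<?_; _≰_)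
import Data.Nat as ℕ
open import Data.Nat.ListAction using (sum)
open import Data.Nat.Properties
import Data.Nat.Tactic.RingSolver as ℕ-Solver
open import Data.Product using (_,_; proj₁; proj₂)
open import Data.Vec using (Vec; []; _∷_; zipWith; tabulate)
import Data.Vec as Vec
open import Function using (_∘_; id)
open import Function.Bundles using (Equivalence)
open import Relation.Binary.PropositionalEquality
open import Relation.Nullary using (Dec; yes; no; does; ¬_)
open import Relation.Nullary.Decidable using (T?)
open import Relation.Nullary.Negation using (contradiction)

-- Conjugates of partitions

entry : List ℕ → ℕ → ℕ
entry []       _       = 0
entry (x ∷ xs) zero    = x
entry (x ∷ xs) (suc t) = entry xs t

Antitone : List ℕ → Set
Antitone xs = ∀ t → entry xs (suc t) ≤ entry xs t

largest : List ℕ → ℕ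
largest = foldr _⊔_ 0

All-≤-largest : ∀ xs → All (_≤ largest xs) xs
All-≤-largest []       = []
All-≤-largest (x ∷ xs) =
  m≤m⊔n x (largest xs) ∷ All.map (λ y≤ → ≤-trans y≤ (m≤n⊔m x (largest xs))) (All-≤-largest xs)

All-≤-head : ∀ {x} xs → Antitone (x ∷ xs) → All (_≤ x) xs
All-≤-head []       _    = []
All-≤-head (y ∷ ys) anti = anti 0 ∷ All.map (λ z≤y → ≤-trans z≤y (anti 0)) (All-≤-head ys (anti ∘ suc))

conjAt-∷-≤ : ∀ {k x} xs → k ≤ x → conjAt (x ∷ xs) k ≡ suc (conjAt xs k)
conjAt-∷-≤ {k} {x} xs k≤x with k ℕ.≤ᵇ x | ≤⇒≤ᵇ k≤x
... | true | _ = refl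

conjAt-∷-> : ∀ {k x} xs → x < k → conjAt (x ∷ xs) k ≡ conjAt xs k
conjAt-∷-> {k} {x} xs x<k with k ℕ.≤ᵇ x | ≤ᵇ⇒≤ k x
... | false | _   = refl
... | true  | k≤x = contradiction (k≤x _) (<⇒≱ x<k)

conjAt-antitone : ∀ xs {k l} → k ≤ l → conjAt xs l ≤ conjAt xs k
conjAt-antitone []       _ = z≤n
conjAt-antitone (x ∷ xs) {k} {l} k≤l with l ≤? x | k ≤? x
... | yes l≤x | _ rewrite conjAt-∷-≤ xs l≤x | conjAt-∷-≤ xs (≤-trans k≤l l≤x) =
  s≤s (conjAt-antitone xs k≤l)
... | no l≰x | yes k≤x rewrite conjAt-∷-> xs (≰⇒> l≰x) | conjAt-∷-≤ xs k≤x =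
  m≤n⇒m≤1+n (conjAt-antitone xs k≤l)
... | no l≰x | no k≰x rewrite conjAt-∷-> xs (≰⇒> l≰x) | conjAt-∷-> xs (≰⇒> k≰x) =
  conjAt-antitone xs k≤l

conjAt-beyond : ∀ {t} xs → All (_≤ t) xs → conjAt xs (suc t) ≡ 0
conjAt-beyond []       []           = refl
conjAt-beyond (x ∷ xs) (x≤t ∷ xs≤t) = trans (conjAt-∷-> xs (s≤s x≤t)) (conjAt-beyond xs xs≤t)

conjAt-above-head : ∀ {x c} xs → Antitone (x ∷ xs) → x < c → conjAt xs c ≡ 0
conjAt-above-head {c = suc t} xs anti (s≤s x≤t) =
  conjAt-beyond xs (All.map (λ y≤x → ≤-trans y≤x x≤t) (All-≤-head xs anti))

entry-applyUpTo-< : ∀ f {B t} → t < B → entry (applyUpTo f B) t ≡ f t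
entry-applyUpTo-< f {suc B} {zero}  _         = refl
entry-applyUpTo-< f {suc B} {suc t} (s≤s t<B) = entry-applyUpTo-< (f ∘ suc) t<B

entry-applyUpTo-≥ : ∀ f {B t} → B ≤ t → entry (applyUpTo f B) t ≡ 0
entry-applyUpTo-≥ f {zero}          _         = refl
entry-applyUpTo-≥ f {suc B} {suc t} (s≤s B≤t) = entry-applyUpTo-≥ (f ∘ suc) B≤t

entry-conj : ∀ xs t → entry (conj xs) t ≡ conjAt xs (suc t)
entry-conj xs t with t <? largest xs
... | yes t<max = entry-applyUpTo-< _ t<max
... | no t≮max  = trans (entry-applyUpTo-≥ _ max≤t) (sym (conjAt-beyond xs xs≤t))
  where
  max≤t = ≮⇒≥ t≮max
  xs≤t  = All.map (λ x≤max → ≤-trans x≤max max≤t) (All-≤-largest xs)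

conj-antitone : ∀ xs → Antitone (conj xs)
conj-antitone xs t rewrite entry-conj xs (suc t) | entry-conj xs t = conjAt-antitone xs (n≤1+n (suc t))

entry-decAt-here : ∀ j xs → entry (decAt (suc j) xs) j ≡ entry xs j ∸ 1
entry-decAt-here j       []       = refl
entry-decAt-here zero    (x ∷ xs) = refl
entry-decAt-here (suc j) (x ∷ xs) = entry-decAt-here j xs

entry-decAt-elsewhere : ∀ j xs {t} → t ≢ j → entry (decAt (suc j) xs) t ≡ entry xs t
entry-decAt-elsewhere j       []       _ = refl
entry-decAt-elsewhere zero    (x ∷ xs) {zero}  t≢j = contradiction refl t≢j
entry-decAt-elsewhere zero    (x ∷ xs) {suc t} _   = refl
entry-decAt-elsewhere (suc j) (x ∷ xs) {zero}  _   = refl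
entry-decAt-elsewhere (suc j) (x ∷ xs) {suc t} t≢j = entry-decAt-elsewhere j xs (t≢j ∘ cong suc)

decAt-antitone : ∀ j xs → Antitone xs → entry xs (suc j) < entry xs j → Antitone (decAt (suc j) xs)
decAt-antitone j xs anti gap t with t ≟ j | suc t ≟ j
... | yes refl | _
  rewrite entry-decAt-elsewhere t xs 1+n≢n | entry-decAt-here t xs = ∸-monoˡ-≤ 1 gap
... | no t≢j | yes refl
  rewrite entry-decAt-here (suc t) xs | entry-decAt-elsewhere (suc t) xs t≢j = ≤-trans (m∸n≤m _ 1) (anti t)
... | no t≢j | no 1+t≢j
  rewrite entry-decAt-elsewhere j xs t≢j | entry-decAt-elsewhere j xs 1+t≢j = anti t

sum-drop-entry : ∀ K xs → sum (drop K xs) ≡ entry xs K + sum (drop (suc K) xs)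
sum-drop-entry zero    []       = refl
sum-drop-entry (suc K) []       = refl
sum-drop-entry zero    (x ∷ xs) = refl
sum-drop-entry (suc K) (x ∷ xs) = sum-drop-entry K xs

drop-decAt : ∀ j xs {K} → j < K → drop K (decAt (suc j) xs) ≡ drop K xs
drop-decAt j       []       _         = refl
drop-decAt zero    (x ∷ xs) {suc K} _ = refl
drop-decAt (suc j) (x ∷ xs) {suc K} (s≤s j<K) = drop-decAt j xs j<K

suc-sum-drop-decAt : ∀ j xs {K} → K ≤ j → 0 < entry xs j →
                     suc (sum (drop K (decAt (suc j) xs))) ≡ sum (drop K xs)
suc-sum-drop-decAt j       []           _ ()
suc-sum-drop-decAt zero    (suc x ∷ xs) {zero}  _ _ = refl
suc-sum-drop-decAt (suc j) (x ∷ xs)     {zero}  _ pos =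
  trans (sym (+-suc x _)) (cong (λ s → x + s) (suc-sum-drop-decAt j xs z≤n pos))
suc-sum-drop-decAt (suc j) (x ∷ xs)     {suc K} (s≤s K≤j) pos = suc-sum-drop-decAt j xs K≤j pos

applyUpTo-cong : ∀ {A : Set} {f g : ℕ → A} → f ≗ g → ∀ B → applyUpTo f B ≡ applyUpTo g B
applyUpTo-cong f≗g zero    = refl
applyUpTo-cong f≗g (suc B) = cong₂ _∷_ (f≗g 0) (applyUpTo-cong (f≗g ∘ suc) B)

drop-applyUpTo : ∀ {A : Set} K (f : ℕ → A) B → drop K (applyUpTo f B) ≡ applyUpTo (λ i → f (K + i)) (B ∸ K)
drop-applyUpTo zero    f B       = refl
drop-applyUpTo (suc K) f zero    = refl
drop-applyUpTo (suc K) f (suc B) = drop-applyUpTo K (f ∘ suc) B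

sum-map-∸ : ∀ K xs → sum (map (_∸ K) xs) ≡ conjAt xs (suc K) + sum (map (_∸ suc K) xs)
sum-map-∸ K []       = refl
sum-map-∸ K (x ∷ xs) = by-cases (suc K ≤? x)
  where
  open ≡-Reasoning
  rest = sum (map (_∸ suc K) xs)
  by-cases : Dec (suc K ≤ x) →
             sum (map (_∸ K) (x ∷ xs)) ≡ conjAt (x ∷ xs) (suc K) + sum (map (_∸ suc K) (x ∷ xs))
  by-cases (yes K<x) = begin
    x ∸ K + sum (map (_∸ K) xs)
      ≡⟨ cong₂ _+_ (+-∸-assoc 1 K<x) (sum-map-∸ K xs) ⟩
    suc (x ∸ suc K) + (conjAt xs (suc K) + rest)
      ≡⟨ cong suc (x+[y+z]≡y+[x+z] (x ∸ suc K) (conjAt xs (suc K)) rest) ⟩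
    suc (conjAt xs (suc K)) + (x ∸ suc K + rest)
      ≡⟨ cong (_+ (x ∸ suc K + rest)) (sym (conjAt-∷-≤ xs K<x)) ⟩
    conjAt (x ∷ xs) (suc K) + (x ∸ suc K + rest) ∎
    where
    x+[y+z]≡y+[x+z] : ∀ x y z → x + (y + z) ≡ y + (x + z)
    x+[y+z]≡y+[x+z] = ℕ-Solver.solve-∀
  by-cases (no K≮x) = begin
    x ∸ K + sum (map (_∸ K) xs)
      ≡⟨ cong₂ _+_ (m≤n⇒m∸n≡0 x≤K) (sum-map-∸ K xs) ⟩
    conjAt xs (suc K) + rest
      ≡⟨ cong₂ _+_ (sym (conjAt-∷-> xs (s≤s x≤K))) (cong (_+ rest) (sym (m≤n⇒m∸n≡0 (m≤n⇒m≤1+n x≤K)))) ⟩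
    conjAt (x ∷ xs) (suc K) + (x ∸ suc K + rest) ∎
    where x≤K = s≤s⁻¹ (≰⇒> K≮x)

sum-map-∸-vanishes : ∀ {K} xs → All (_≤ K) xs → sum (map (_∸ K) xs) ≡ 0
sum-map-∸-vanishes []       []           = refl
sum-map-∸-vanishes (x ∷ xs) (x≤K ∷ xs≤K) rewrite m≤n⇒m∸n≡0 x≤K = sum-map-∸-vanishes xs xs≤K

-- Both sides count the cells of the Young diagram of xs lying in columns K+1, …, K+B:
-- column by column on the left, row by row on the right.
sum-applyUpTo-conjAt : ∀ K B xs → All (_≤ K + B) xs →
                       sum (applyUpTo (λ i → conjAt xs (suc (K + i))) B) ≡ sum (map (_∸ K) xs)
sum-applyUpTo-conjAt K zero xs bound =
  sym (sum-map-∸-vanishes xs (All.map (λ x≤ → ≤-trans x≤ (≤-reflexive (+-identityʳ K))) bound))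
sum-applyUpTo-conjAt K (suc B) xs bound = begin
  conjAt xs (suc (K + 0)) + sum (applyUpTo (λ i → conjAt xs (suc (K + suc i))) B)
    ≡⟨ cong₂ _+_ (cong (conjAt xs ∘ suc) (+-identityʳ K))
                 (cong sum (applyUpTo-cong (λ i → cong (conjAt xs ∘ suc) (+-suc K i)) B)) ⟩
  conjAt xs (suc K) + sum (applyUpTo (λ i → conjAt xs (suc (suc K + i))) B)
    ≡⟨ cong (λ s → conjAt xs (suc K) + s) (sum-applyUpTo-conjAt (suc K) B xs bound′) ⟩
  conjAt xs (suc K) + sum (map (_∸ suc K) xs)
    ≡⟨ sym (sum-map-∸ K xs) ⟩
  sum (map (_∸ K) xs) ∎
  where
  open ≡-Reasoning
  bound′ = All.map (λ x≤ → ≤-trans x≤ (≤-reflexive (+-suc K B))) bound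

sum-drop-conj : ∀ K xs → sum (drop K (conj xs)) ≡ sum (map (_∸ K) xs)
sum-drop-conj K xs = trans (cong sum (drop-applyUpTo K _ (largest xs)))
                           (sum-applyUpTo-conjAt K (largest xs ∸ K) xs bound)
  where bound = All.map (λ x≤ → ≤-trans x≤ (m≤n+m∸n (largest xs) K)) (All-≤-largest xs)

conjAt-drop : ∀ K xs {c} → Antitone xs → conjAt (drop K xs) c ≡ conjAt xs c ∸ K
conjAt-drop zero    xs       _ = refl
conjAt-drop (suc K) []       _ = refl
conjAt-drop (suc K) (x ∷ xs) {c} anti with c ≤? x
... | yes c≤x rewrite conjAt-∷-≤ xs c≤x = conjAt-drop K xs {c} (anti ∘ suc)
... | no c≰x  rewrite conjAt-∷-> xs (≰⇒> c≰x) | conjAt-drop K xs {c} (anti ∘ suc)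
                    | conjAt-above-head xs anti (≰⇒> c≰x) = 0∸n≡0 K

sum-map-∸-conj : ∀ K xs → Antitone xs → sum (map (_∸ K) (conj xs)) ≡ sum (drop K xs)
sum-map-∸-conj K xs anti = begin
  sum (map (_∸ K) (conj xs))
    ≡⟨ cong sum (List.map-applyUpTo _ (_∸ K) (largest xs)) ⟩
  sum (applyUpTo (λ i → conjAt xs (suc i) ∸ K) (largest xs))
    ≡⟨ cong sum (applyUpTo-cong (λ _ → sym (conjAt-drop K xs anti)) (largest xs)) ⟩
  sum (applyUpTo (λ i → conjAt (drop K xs) (suc i)) (largest xs))
    ≡⟨ sum-applyUpTo-conjAt 0 (largest xs) (drop K xs) (All.drop⁺ K (All-≤-largest xs)) ⟩
  sum (map (_∸ 0) (drop K xs))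
    ≡⟨ cong sum (List.map-id (drop K xs)) ⟩
  sum (drop K xs) ∎
  where open ≡-Reasoning

sum-drop-conj-conj : ∀ K xs → Antitone xs → sum (drop K (conj (conj xs))) ≡ sum (drop K xs)
sum-drop-conj-conj K xs anti = trans (sum-drop-conj K (conj xs)) (sum-map-∸-conj K xs anti)

conjTailSum : ℕ → List ℕ → ℕ
conjTailSum K λ′ = sum (drop K (conj λ′))

module _ (λ′ : List ℕ) where

  lamj-gap : ∀ j → LamjDefined λ′ (suc j) → entry (conj λ′) (suc j) < entry (conj λ′) j
  lamj-gap j defined rewrite entry-conj λ′ (suc j) | entry-conj λ′ j = defined

  conjTailSum-lamj-inside : ∀ j {K} → LamjDefined λ′ (suc j) → K ≤ j →
                            suc (conjTailSum K (lamj λ′ (suc j))) ≡ conjTailSum K λ′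
  conjTailSum-lamj-inside j {K} defined K≤j = trans
    (cong suc (sum-drop-conj-conj K _ (decAt-antitone j (conj λ′) (conj-antitone λ′) (lamj-gap j defined))))
    (suc-sum-drop-decAt j (conj λ′) K≤j (≤-trans (s≤s z≤n) (lamj-gap j defined)))

  conjTailSum-lamj-outside : ∀ j {K} → LamjDefined λ′ j → j ≤ K → conjTailSum K (lamj λ′ j) ≡ conjTailSum K λ′
  conjTailSum-lamj-outside zero    _       _   = refl
  conjTailSum-lamj-outside (suc j) {K} defined j<K = trans
    (sum-drop-conj-conj K _ (decAt-antitone j (conj λ′) (conj-antitone λ′) (lamj-gap j defined)))
    (cong sum (drop-decAt j (conj λ′) j<K))

-- Polynomial arithmetic

coeff-++ : ∀ {n} (p q : Poly n) m → coeff (p ++ q) m ≡ coeff p m ℤ.+ coeff q m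
coeff-++ []            q m = sym (ℤₚ.+-identityˡ (coeff q m))
coeff-++ ((c , u) ∷ p) q m =
  trans (cong (λ r → h ℤ.+ r) (coeff-++ p q m)) (sym (ℤₚ.+-assoc h (coeff p m) (coeff q m)))
  where h = if monoEqᵇ u m then c else + 0

coeff-negP : ∀ {n} (p : Poly n) m → coeff (negP p) m ≡ ℤ.- coeff p m
coeff-negP []            m = refl
coeff-negP ((c , u) ∷ p) m =
  trans (cong₂ ℤ._+_ (if-neg (monoEqᵇ u m)) (coeff-negP p m)) (sym (ℤₚ.neg-distrib-+ h (coeff p m)))
  where
  h = if monoEqᵇ u m then c else + 0
  if-neg : ∀ b → (if b then ℤ.- c else + 0) ≡ ℤ.- (if b then c else + 0)
  if-neg true  = refl
  if-neg false = refl

coeff-difference : ∀ {n} (p q : Poly n) m → coeff (p -P q) m ≡ coeff p m ℤ.- coeff q m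
coeff-difference p q m = trans (coeff-++ p (negP q) m) (cong (λ r → coeff p m ℤ.+ r) (coeff-negP q m))

-P-self : ∀ {n} (p : Poly n) → p -P p ≈P []
-P-self p m = trans (coeff-difference p p m) (ℤₚ.+-inverseʳ (coeff p m))

shift : ∀ {n} → Mono n → Poly n → Poly n
shift u = map (λ (c , v) → (c , zipWith _+_ u v))

coeff-single-*P : ∀ {n} s (u : Mono n) p m → coeff (((s , u) ∷ []) *P p) m ≡ s ℤ.* coeff (shift u p) m
coeff-single-*P s u []            m = sym (ℤₚ.*-zeroʳ s)
coeff-single-*P s u ((c , v) ∷ p) m =
  trans (cong₂ ℤ._+_ (if-* (monoEqᵇ (zipWith _+_ u v) m)) (coeff-single-*P s u p m))
        (sym (ℤₚ.*-distribˡ-+ s _ (coeff (shift u p) m)))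
  where
  if-* : ∀ b → (if b then s ℤ.* c else + 0) ≡ s ℤ.* (if b then c else + 0)
  if-* true  = refl
  if-* false = sym (ℤₚ.*-zeroʳ s)

x1-exp : ∀ {n} → ℕ → Mono n
x1-exp a = tabulate (λ i → if does (toℕ i ℕ.≟ 0) then a else 0)

infix 8 _·x₁^_
_·x₁^_ : ∀ {n} → ℤ → ℕ → Poly n
s ·x₁^ a = (s , x1-exp a) ∷ []

zipWith-+-zeros : ∀ {n} (v : Vec ℕ n) → zipWith _+_ (tabulate (λ _ → 0)) v ≡ v
zipWith-+-zeros []      = refl
zipWith-+-zeros (x ∷ v) = cong (x ∷_) (zipWith-+-zeros v)

shift-x1-exp-shift : ∀ {n} a (p : Poly (suc n)) → shift (x1-exp a) (shift (x1-exp 1) p) ≡ shift (x1-exp (suc a)) p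
shift-x1-exp-shift a [] = refl
shift-x1-exp-shift a ((c , x ∷ v) ∷ p) =
  cong₂ _∷_ (cong (c ,_) (cong₂ _∷_ (+-suc a x) (zipWith-+-zeros _))) (shift-x1-exp-shift a p)

-- Elementary symmetric polynomials

term : ∀ {n} → Subset n → ℤ × Mono n
term T = (+ 1 , toExp T)

selects : ∀ {n} → Subset n → ℤ → Subset n → Bool
selects S d T = ⊆ᵇ T S ∧ does (+ ∣ T ∣ ℤ.≟ d)

filterᵇ-map : ∀ {A B : Set} (p : B → Bool) (f : A → B) xs → filterᵇ p (map f xs) ≡ map f (filterᵇ (p ∘ f) xs)
filterᵇ-map p f []       = refl
filterᵇ-map p f (x ∷ xs) with p (f x)
... | true  = cong (f x ∷_) (filterᵇ-map p f xs)
... | false = filterᵇ-map p f xs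

filterᵇ-cong : ∀ {A : Set} {p q : A → Bool} → p ≗ q → ∀ xs → filterᵇ p xs ≡ filterᵇ q xs
filterᵇ-cong p≗q []       = refl
filterᵇ-cong {q = q} p≗q (x ∷ xs) rewrite p≗q x with q x
... | true  = cong (x ∷_) (filterᵇ-cong p≗q xs)
... | false = filterᵇ-cong p≗q xs

does-+suc≟ : ∀ k d → does (+ suc k ℤ.≟ d) ≡ does (+ k ℤ.≟ d - + 1)
does-+suc≟ k d with + suc k ℤ.≟ d | + k ℤ.≟ d - + 1
... | yes _    | yes _   = refl
... | no _     | no _    = refl
... | yes refl | no k≢   = contradiction (sym (ℤ-suc-pred (+ k))) k≢
  where
  ℤ-suc-pred : ∀ i → + 1 ℤ.+ i - + 1 ≡ i
  ℤ-suc-pred = ℤ-Solver.solve-∀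
... | no 1+k≢  | yes k≡ = contradiction (trans (cong (ℤ._+_ (+ 1)) k≡) (ℤ-pred-suc d)) 1+k≢
  where
  ℤ-pred-suc : ∀ i → + 1 ℤ.+ (i - + 1) ≡ i
  ℤ-pred-suc = ℤ-Solver.solve-∀

module _ {n : ℕ} (S : Subset n) where

  private
    subsets : List (Subset n)
    subsets = allSubsets n

  e-∷ : ∀ b d → e d (b ∷ S) ≡ map term (map (false ∷_) (filterᵇ (selects S d) subsets))
                               ++ map term (map (true ∷_) (filterᵇ (selects (b ∷ S) d ∘ (true ∷_)) subsets))
  e-∷ b d = trans
    (cong (map term) (trans (List.filter-++ (T? ∘ selects (b ∷ S) d) (map (false ∷_) subsets) (map (true ∷_) subsets))
                            (cong₂ _++_ (filterᵇ-map _ _ subsets) (filterᵇ-map _ _ subsets))))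
    (List.map-++ term (map (false ∷_) (filterᵇ (selects S d) subsets)) _)

  e-false : ∀ d → e d (false ∷ S) ≡ map term (map (false ∷_) (filterᵇ (selects S d) subsets))
  e-false d = trans (e-∷ false d)
    (trans (cong (λ Ts → lower ++ map term (map (true ∷_) Ts)) nothing-above) (List.++-identityʳ lower))
    where
    lower = map term (map (false ∷_) (filterᵇ (selects S d) subsets))
    nothing-above = List.filter-none (T? ∘ selects (false ∷ S) d ∘ (true ∷_)) (All.universal (λ _ ()) subsets)

  shift-x1-exp-false : ∀ (Ts : List (Subset n)) →
                       shift (x1-exp 1) (map term (map (false ∷_) Ts)) ≡ map term (map (true ∷_) Ts)
  shift-x1-exp-false []       = refl
  shift-x1-exp-false (T ∷ Ts) =
    cong₂ _∷_ (cong (λ v → (+ 1 , 1 ∷ v)) (zipWith-+-zeros (toExp T))) (shift-x1-exp-false Ts)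

  e-addFirst : ∀ d → e d (true ∷ S) ≡ e d (false ∷ S) ++ shift (x1-exp 1) (e (d - + 1) (false ∷ S))
  e-addFirst d = trans (e-∷ true d) (cong₂ _++_ (sym (e-false d)) (begin
    map term (map (true ∷_) (filterᵇ (selects (true ∷ S) d ∘ (true ∷_)) subsets))
      ≡⟨ cong (λ Ts → map term (map (true ∷_) Ts))
              (filterᵇ-cong (λ T → cong (⊆ᵇ T S ∧_) (does-+suc≟ ∣ T ∣ d)) subsets) ⟩
    map term (map (true ∷_) (filterᵇ (selects S (d - + 1)) subsets))
      ≡⟨ sym (shift-x1-exp-false _) ⟩
    shift (x1-exp 1) (map term (map (false ∷_) (filterᵇ (selects S (d - + 1)) subsets)))
      ≡⟨ cong (shift (x1-exp 1)) (sym (e-false (d - + 1))) ⟩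
    shift (x1-exp 1) (e (d - + 1) (false ∷ S)) ∎))
    where open ≡-Reasoning

  coeff-shift-e-addFirst : ∀ a d m →
    coeff (shift (x1-exp a) (e d (true ∷ S))) m
      ≡ coeff (shift (x1-exp a) (e d (false ∷ S))) m
        ℤ.+ coeff (shift (x1-exp (suc a)) (e (d - + 1) (false ∷ S))) m
  coeff-shift-e-addFirst a d m = begin
    coeff (shift (x1-exp a) (e d (true ∷ S))) m
      ≡⟨ cong (λ p → coeff (shift (x1-exp a) p) m) (e-addFirst d) ⟩
    coeff (shift (x1-exp a) (e d (false ∷ S) ++ shift (x1-exp 1) e′)) m
      ≡⟨ cong (λ p → coeff p m) (List.map-++ _ (e d (false ∷ S)) _) ⟩
    coeff (shift (x1-exp a) (e d (false ∷ S)) ++ shift (x1-exp a) (shift (x1-exp 1) e′)) m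
      ≡⟨ coeff-++ (shift (x1-exp a) (e d (false ∷ S))) _ m ⟩
    coeff (shift (x1-exp a) (e d (false ∷ S))) m ℤ.+ coeff (shift (x1-exp a) (shift (x1-exp 1) e′)) m
      ≡⟨ cong (λ p → coeff (shift (x1-exp a) (e d (false ∷ S))) m ℤ.+ coeff p m)
              (shift-x1-exp-shift a e′) ⟩
    coeff (shift (x1-exp a) (e d (false ∷ S))) m ℤ.+ coeff (shift (x1-exp (suc a)) e′) m ∎
    where
    open ≡-Reasoning
    e′ = e (d - + 1) (false ∷ S)

  x1^-*P-e-addFirst-difference : ∀ a d →
    x1^ a *P e d (true ∷ S) -P x1^ a *P e d (false ∷ S) ≈P x1^ (suc a) *P e (d - + 1) (false ∷ S)
  x1^-*P-e-addFirst-difference a d m = begin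
    coeff (x1^ a *P e d (true ∷ S) -P x1^ a *P e d (false ∷ S)) m
      ≡⟨ coeff-difference (x1^ a *P e d (true ∷ S)) _ m ⟩
    coeff (x1^ a *P e d (true ∷ S)) m ℤ.- coeff (x1^ a *P e d (false ∷ S)) m
      ≡⟨ cong₂ ℤ._-_ (trans (coeff-single-*P (+ 1) (x1-exp a) (e d (true ∷ S)) m)
                            (cong (+ 1 ℤ.*_) (coeff-shift-e-addFirst a d m)))
                     (coeff-single-*P (+ 1) (x1-exp a) (e d (false ∷ S)) m) ⟩
    + 1 ℤ.* (B ℤ.+ C) ℤ.- + 1 ℤ.* B
      ≡⟨ cancel B C ⟩
    + 1 ℤ.* C
      ≡⟨ sym (coeff-single-*P (+ 1) (x1-exp (suc a)) (e (d - + 1) (false ∷ S)) m) ⟩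
    coeff (x1^ (suc a) *P e (d - + 1) (false ∷ S)) m ∎
    where
    open ≡-Reasoning
    B = coeff (shift (x1-exp a) (e d (false ∷ S))) m
    C = coeff (shift (x1-exp (suc a)) (e (d - + 1) (false ∷ S))) m
    cancel : ∀ x y → + 1 ℤ.* (x ℤ.+ y) ℤ.- + 1 ℤ.* x ≡ + 1 ℤ.* y
    cancel = ℤ-Solver.solve-∀

-- Homogeneity

does-sound : ∀ {A : Set} (a? : Dec A) → T (does a?) → A
does-sound (yes a) _ = a

monoEqᵇ-sound : ∀ {n} (u v : Mono n) → T (monoEqᵇ u v) → u ≡ v
monoEqᵇ-sound []      []      _  = refl
monoEqᵇ-sound (a ∷ u) (b ∷ v) eq =
  cong₂ _∷_ (does-sound (a ℕ.≟ b) (proj₁ split)) (monoEqᵇ-sound u v (proj₂ split))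
  where split = Equivalence.to T-∧ eq

homogeneous : ∀ {n} k (p : Poly n) → All (λ t → Vec.sum (proj₂ t) ≡ k) p → Homogeneous p
homogeneous k p degrees = k , support-degree p degrees
  where
  support-degree : ∀ p → All (λ t → Vec.sum (proj₂ t) ≡ k) p → ∀ m → ¬ coeff p m ≡ + 0 → Vec.sum m ≡ k
  support-degree []            []       m nz = contradiction refl nz
  support-degree ((c , u) ∷ p) (deg ∷ degs) m nz with monoEqᵇ u m in eq
  ... | true  = trans (cong Vec.sum (sym (monoEqᵇ-sound u m (subst T (sym eq) _)))) deg
  ... | false = support-degree p degs m (nz ∘ trans (ℤₚ.+-identityˡ (coeff p m)))

sum-zipWith-+ : ∀ {n} (u v : Vec ℕ n) → Vec.sum (zipWith _+_ u v) ≡ Vec.sum u + Vec.sum v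
sum-zipWith-+ []      []      = refl
sum-zipWith-+ (a ∷ u) (b ∷ v) = trans (cong (λ s → a + b + s) (sum-zipWith-+ u v)) (interchange a b _ _)
  where
  interchange : ∀ a b c d → a + b + (c + d) ≡ a + c + (b + d)
  interchange = ℕ-Solver.solve-∀

sum-x1-exp : ∀ {n} a → Vec.sum (x1-exp {suc n} a) ≡ a
sum-x1-exp {n} a = trans (cong (λ s → a + s) (sum-zeros n)) (+-identityʳ a)
  where
  sum-zeros : ∀ n → Vec.sum (tabulate {n = n} (λ _ → 0)) ≡ 0
  sum-zeros zero    = refl
  sum-zeros (suc n) = sum-zeros n

sum-toExp : ∀ {n} (T : Subset n) → Vec.sum (toExp T) ≡ ∣ T ∣
sum-toExp []         = refl
sum-toExp (true ∷ T)  = cong suc (sum-toExp T)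
sum-toExp (false ∷ T) = sum-toExp T

x1^-*P-e-homogeneous : ∀ {n} a d (U : Subset (suc n)) → Homogeneous (x1^ a *P e d U)
x1^-*P-e-homogeneous {n} a d U = homogeneous (a + ℤ.∣ d ∣) (x1^ a *P e d U)
  (All.++⁺ (All.gmap⁺ id (All.gmap⁺ (λ {V} → degree {V}) selected-all)) [])
  where
  selected-all = All.all-filter (T? ∘ selects U d) (allSubsets (suc n))
  degree : ∀ {V} → T (selects U d V) → Vec.sum (zipWith _+_ (x1-exp a) (toExp V)) ≡ a + ℤ.∣ d ∣
  degree {V} selected = trans (sum-zipWith-+ (x1-exp a) (toExp V))
    (cong₂ _+_ (sum-x1-exp {n} a) (trans (sum-toExp V) (cong ℤ.∣_∣ size≡d)))
    where size≡d = does-sound (+ ∣ V ∣ ℤ.≟ d) (proj₂ (Equivalence.to (T-∧ {⊆ᵇ V U}) selected))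

-- The ideal J_{n,λ}

threshold : ∀ {n} → List ℕ → Subset n → ℤ
threshold {n} λ′ U = + ∣ U ∣ - + pNm n ∣ U ∣ λ′

module _ {n : ℕ} (λ′ : List ℕ) where

  InJ-resp-≈P : ∀ {p q : Poly n} → p ≈P q → InJ n λ′ q → InJ n λ′ p
  InJ-resp-≈P p≈q (gs , valid , q≈) = gs , valid , λ m → trans (p≈q m) (q≈ m)

  InJ-+P : ∀ {p q : Poly n} → InJ n λ′ p → InJ n λ′ q → InJ n λ′ (p +P q)
  InJ-+P {p} {q} (gs , gs-valid , p≈) (hs , hs-valid , q≈) = gs ++ hs , All.++⁺ gs-valid hs-valid , λ m → begin
    coeff (p ++ q) m
      ≡⟨ coeff-++ p q m ⟩
    coeff p m ℤ.+ coeff q m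
      ≡⟨ cong₂ ℤ._+_ (p≈ m) (q≈ m) ⟩
    coeff (sumP G) m ℤ.+ coeff (sumP H) m
      ≡⟨ sym (coeff-++ (sumP G) (sumP H) m) ⟩
    coeff (sumP G ++ sumP H) m
      ≡⟨ cong (λ r → coeff r m) (List.concat-++ G H) ⟩
    coeff (sumP (G ++ H)) m
      ≡⟨ cong (λ r → coeff (sumP r) m) (sym (List.map-++ genVal gs hs)) ⟩
    coeff (sumP (map genVal (gs ++ hs))) m ∎
    where
    open ≡-Reasoning
    G = map genVal gs
    H = map genVal hs

  InJ-generator : ∀ (c : Poly n) {U d} → threshold λ′ U ℤ.< d → InJ n λ′ (c *P e d U)
  InJ-generator c {U} {d} valid =
    (c , U , d) ∷ [] , valid ∷ [] , λ m → cong (λ r → coeff r m) (sym (List.++-identityʳ (c *P e d U)))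

module _ {n : ℕ} (λ′ : List ℕ) (S : Subset n) where

  private
    S₀ S₁ : Subset (suc n)
    S₀ = false ∷ S
    S₁ = true ∷ S

  ·x₁^-*P-e-step : ∀ s a d →
    (s ·x₁^ suc a) *P e d S₀ ≈P (s ·x₁^ a) *P e (d ℤ.+ + 1) S₁ +P ((ℤ.- s) ·x₁^ a) *P e (d ℤ.+ + 1) S₀
  ·x₁^-*P-e-step s a d m = begin
    coeff ((s ·x₁^ suc a) *P e d S₀) m
      ≡⟨ coeff-single-*P s (x1-exp (suc a)) (e d S₀) m ⟩
    s ℤ.* C
      ≡⟨ split s B C ⟩
    s ℤ.* (B ℤ.+ C) ℤ.+ ℤ.- s ℤ.* B
      ≡⟨ cong (λ r → s ℤ.* r ℤ.+ ℤ.- s ℤ.* B) (sym A≡B+C) ⟩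
    s ℤ.* A ℤ.+ ℤ.- s ℤ.* B
      ≡⟨ sym (cong₂ ℤ._+_ (coeff-single-*P s (x1-exp a) (e d′ S₁) m)
                          (coeff-single-*P (ℤ.- s) (x1-exp a) (e d′ S₀) m)) ⟩
    coeff ((s ·x₁^ a) *P e d′ S₁) m ℤ.+ coeff (((ℤ.- s) ·x₁^ a) *P e d′ S₀) m
      ≡⟨ sym (coeff-++ ((s ·x₁^ a) *P e d′ S₁) _ m) ⟩
    coeff ((s ·x₁^ a) *P e d′ S₁ +P ((ℤ.- s) ·x₁^ a) *P e d′ S₀) m ∎
    where
    open ≡-Reasoning
    d′ = d ℤ.+ + 1
    A = coeff (shift (x1-exp a) (e d′ S₁)) m
    B = coeff (shift (x1-exp a) (e d′ S₀)) m
    C = coeff (shift (x1-exp (suc a)) (e d S₀)) m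
    d′-1 : ∀ d → d ℤ.+ + 1 - + 1 ≡ d
    d′-1 = ℤ-Solver.solve-∀
    A≡B+C : A ≡ B ℤ.+ C
    A≡B+C = trans (coeff-shift-e-addFirst S a d′ m)
                  (cong (λ d″ → B ℤ.+ coeff (shift (x1-exp (suc a)) (e d″ S₀)) m) (d′-1 d))
    split : ∀ s b c → s ℤ.* c ≡ s ℤ.* (b ℤ.+ c) ℤ.+ ℤ.- s ℤ.* b
    split = ℤ-Solver.solve-∀

  ·x₁^-*P-e-∈J : ∀ s a d → threshold λ′ S₁ ℤ.≤ d → threshold λ′ S₀ ℤ.< d ℤ.+ + a →
                 InJ (suc n) λ′ ((s ·x₁^ a) *P e d S₀)
  ·x₁^-*P-e-∈J s zero    d S₁-valid S₀-valid =
    InJ-generator λ′ (s ·x₁^ 0) (subst (threshold λ′ S₀ ℤ.<_) (ℤₚ.+-identityʳ d) S₀-valid)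
  ·x₁^-*P-e-∈J s (suc a) d S₁-valid S₀-valid =
    InJ-resp-≈P λ′ {(s ·x₁^ suc a) *P e d S₀} {p₁ +P p₀} (·x₁^-*P-e-step s a d)
      (InJ-+P λ′ {p₁} {p₀} (InJ-generator λ′ (s ·x₁^ a) (ℤₚ.≤-<-trans S₁-valid d<d′))
               (·x₁^-*P-e-∈J (ℤ.- s) a (d ℤ.+ + 1) (ℤₚ.≤-trans S₁-valid (ℤₚ.<⇒≤ d<d′))
                             (subst (threshold λ′ S₀ ℤ.<_) (shift-one d (+ a)) S₀-valid)))
    where
    p₁ = (s ·x₁^ a) *P e (d ℤ.+ + 1) S₁
    p₀ = ((ℤ.- s) ·x₁^ a) *P e (d ℤ.+ + 1) S₀
    d<d′ : d ℤ.< d ℤ.+ + 1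
    d<d′ = ℤₚ.suc[i]≤j⇒i<j (ℤₚ.≤-reflexive (ℤₚ.+-comm (+ 1) d))
    shift-one : ∀ d a → d ℤ.+ (+ 1 ℤ.+ a) ≡ d ℤ.+ + 1 ℤ.+ a
    shift-one = ℤ-Solver.solve-∀

-- The generators needed for F_{d,S}

m∸n≤o⇒m∸o≤n : ∀ m n o → m ∸ n ≤ o → m ∸ o ≤ n
m∸n≤o⇒m∸o≤n m n o m∸n≤o = m≤n+o⇒m∸n≤o m o (begin
  m           ≤⟨ m≤n+m∸n m n ⟩
  n + (m ∸ n) ≤⟨ +-monoʳ-≤ n m∸n≤o ⟩
  n + o       ≡⟨ +-comm n o ⟩
  o + n       ∎)
  where open ≤-Reasoning

m∸n≰o⇒n≤m∸1+o : ∀ m n o → m ∸ n ≰ o → n ≤ m ∸ suc o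
m∸n≰o⇒n≤m∸1+o m n o m∸n≰o =
  m+n≤o⇒m≤o∸n n (subst (_≤ m) (+-comm (suc o) n) (m≤o∸n⇒m+n≤o (suc o) n≤m o<m∸n))
  where
  o<m∸n = ≰⇒> m∸n≰o
  n≤m = <⇒≤ (m∸n≢0⇒n<m (λ m∸n≡0 → contradiction (subst (o <_) m∸n≡0 o<m∸n) λ ()))

addFirst-above-threshold : ∀ {n} λ′ j (S : Subset n) {d} → LamjDefined λ′ j →
  + ∣ S ∣ - + pNm n ∣ S ∣ (lamj λ′ j) ℤ.< d → suc n ∸ j ≤ ∣ S ∣ → threshold λ′ (true ∷ S) ℤ.< d
addFirst-above-threshold {n} λ′ zero    S _ _ big = contradiction (≤-trans big (∣p∣≤n S)) (n≮n n)
addFirst-above-threshold {n} λ′ (suc j) S {d} defined above big = subst (ℤ._< d) (begin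
  + m - + P′               ≡⟨ sym (cancel-suc (+ m) (+ P′)) ⟩
  + suc m - + suc P′       ≡⟨ cong (λ p → + suc m - + p) (conjTailSum-lamj-inside λ′ j defined K≤j) ⟩
  + suc m - + conjTailSum K λ′ ∎) above
  where
  open ≡-Reasoning
  m = ∣ S ∣
  K = n ∸ m
  P′ = conjTailSum K (lamj λ′ (suc j))
  K≤j = m∸n≤o⇒m∸o≤n n j m big
  cancel-suc : ∀ x y → + 1 ℤ.+ x - (+ 1 ℤ.+ y) ≡ x - y
  cancel-suc = ℤ-Solver.solve-∀

keep-thresholds : ∀ {n} λ′ j (S : Subset n) {d} → LamjDefined λ′ j →
  + ∣ S ∣ - + pNm n ∣ S ∣ (lamj λ′ j) ℤ.< d → suc n ∸ j ≰ ∣ S ∣ →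
  threshold λ′ (true ∷ S) ℤ.≤ d × threshold λ′ (false ∷ S) ℤ.< d ℤ.+ + conjAt λ′ (suc j)
keep-thresholds {n} λ′ j S {d} defined above small = S₁-valid , S₀-valid
  where
  m = ∣ S ∣
  K = n ∸ m
  j≤K = m∸n≰o⇒n≤m∸1+o (suc n) j m small
  P = conjTailSum K λ′
  b = entry (conj λ′) K
  R = conjTailSum (suc K) λ′
  above′ : + m - + P ℤ.< d
  above′ = subst (λ p → + m - + p ℤ.< d) (conjTailSum-lamj-outside λ′ j defined j≤K) above
  S₁-valid : + suc m - + P ℤ.≤ d
  S₁-valid = subst (ℤ._≤ d) (suc-assoc (+ m) (+ P)) (ℤₚ.i<j⇒suc[i]≤j above′)
    where
    suc-assoc : ∀ x y → + 1 ℤ.+ (x - y) ≡ + 1 ℤ.+ x - y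
    suc-assoc = ℤ-Solver.solve-∀
  b≤a : b ≤ conjAt λ′ (suc j)
  b≤a = subst (_≤ conjAt λ′ (suc j)) (sym (entry-conj λ′ K)) (conjAt-antitone λ′ (s≤s j≤K))
  S₀-valid : + m - + conjTailSum (suc n ∸ m) λ′ ℤ.< d ℤ.+ + conjAt λ′ (suc j)
  S₀-valid = subst (λ k → + m - + conjTailSum k λ′ ℤ.< d ℤ.+ + conjAt λ′ (suc j)) (sym (+-∸-assoc 1 (∣p∣≤n S)))
    (subst (ℤ._< d ℤ.+ + conjAt λ′ (suc j)) drop-column (ℤₚ.+-mono-<-≤ above′ (ℤ.+≤+ b≤a)))
    where
    cancel : ∀ x y z → x - (y ℤ.+ z) ℤ.+ y ≡ x - z
    cancel = ℤ-Solver.solve-∀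
    drop-column : + m - + P ℤ.+ + b ≡ + m - + R
    drop-column = trans (cong (λ p → + m - + p ℤ.+ + b) (sum-drop-entry K (conj λ′))) (cancel (+ m) (+ b) (+ R))

lemmaL : (n : ℕ) → 1 < n → (λ′ : List ℕ) → IsPartition λ′ → 1 ≤ size λ′ → size λ′ ≤ suc n →
    (j : ℕ) → LamjDefined λ′ j →
    (S : Subset n) → FirstNotIn S → (d : ℤ) →
    Data.Integer._<_ (+ ∣ S ∣ - + pNm (Data.Nat._∸_ n 1) ∣ S ∣ (lamj λ′ j)) d →
    Homogeneous (F n j (conjAt λ′ (suc j)) d S)
    × InJ n λ′ (F n j (conjAt λ′ (suc j)) d S)
    × (x1^ (suc (conjAt λ′ (suc j))) ∣P (F n j (conjAt λ′ (suc j)) d S -P x1^ (conjAt λ′ (suc j)) *P e d S))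
lemmaL (suc n) _ λ′ _ _ _ j defined (true ∷ S) 1∉S d above = contradiction (1∉S Data.Fin.zero refl) λ ()
lemmaL (suc n) _ λ′ _ _ _ j defined (false ∷ S) _ d above = properties (suc n ∸ j ≤? ∣ S ∣)
  where
  a = conjAt λ′ (suc j)
  properties : (big? : Dec (suc n ∸ j ≤ ∣ S ∣)) →
    let F = if does big? then x1^ a *P e d (true ∷ S) else x1^ a *P e d (false ∷ S)
    in Homogeneous F × InJ (suc n) λ′ F × (x1^ (suc a) ∣P (F -P x1^ a *P e d (false ∷ S)))
  properties (yes big) =
    x1^-*P-e-homogeneous a d (true ∷ S) ,
    InJ-generator λ′ (x1^ a) (addFirst-above-threshold λ′ j S defined above big) ,
    e (d - + 1) (false ∷ S) , x1^-*P-e-addFirst-difference S a d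
  properties (no small) with keep-thresholds λ′ j S defined above small
  ... | S₁-valid , S₀-valid =
    x1^-*P-e-homogeneous a d (false ∷ S) ,
    ·x₁^-*P-e-∈J λ′ S (+ 1) a d S₁-valid S₀-valid ,
    [] , -P-self (x1^ a *P e d (false ∷ S))
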